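{- Let $p,q\in\mathbb{N}[X_1,\ldots,X_m]$ be polynomials with natural coefficients. Then the equation $p(\vec X)=q(\vec X)$ has a solution in $\mathbf{P}^m$ if and only if it has a solution in $\mathbb{N}^m$.
   Context: A profile is a sequence $\mathbf{p}=(p_i)_{i\in\mathbb{N}}$ of natural numbers for which there exists $h\ge -1$ with $p_i\ge 1$ for $0\le i\le h$ and $p_i=0$ for $i>h$. $\mathbf{P}$ is the set of profiles, a commutative semiring with elementwise sum and product $(\mathbf{p}\times\mathbf{q})_i = p_i\sum_{j=0}^i q_j + q_i\sum_{j=0}^i p_j - p_i q_i$. Natural numbers $n$ are identified with the profiles $(n)=(n,0,0,\ldots)$, which makes $\mathbb{N}$ a subsemiring of $\mathbf{P}$; thus natural coefficients and natural solutions are interpreted inside $\mathbf{P}$. -}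

module Defs where

open import Data.Nat using (ℕ; zero; suc; _+_; _*_; _∸_; _^_; _≤_; _<_)
open import Data.Fin using (Fin; zero; suc)
open import Data.List using (List; foldr)
open import Data.Product using (_×_; _,_; ∃-syntax)
open import Relation.Binary.PropositionalEquality using (_≡_)

Seq : Set
Seq = ℕ → ℕ

-- p is a profile iff there is H (= paper's h + 1, so H ≥ 0 ⇔ h ≥ -1)
-- with p i ≥ 1 for i < H and p i = 0 for i ≥ H.
IsProfile : Seq → Set
IsProfile p = ∃[ H ] ((∀ i → i < H → 1 ≤ p i) × (∀ i → H ≤ i → p i ≡ 0))

psum : Seq → ℕ → ℕ
psum p zero    = p zero
psum p (suc i) = psum p i + p (suc i)

_⊕_ : Seq → Seq → Seq
(p ⊕ q) i = p i + q i

_⊗_ : Seq → Seq → Seq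
(p ⊗ q) i = (p i * psum q i + q i * psum p i) ∸ p i * q i

embed : ℕ → Seq
embed n zero    = n
embed n (suc _) = 0

powP : Seq → ℕ → Seq
powP x zero    = embed 1
powP x (suc k) = x ⊗ powP x k

prodFinP : ∀ m → (Fin m → Seq) → Seq
prodFinP zero    f = embed 1
prodFinP (suc m) f = f zero ⊗ prodFinP m (λ i → f (suc i))

prodFinℕ : ∀ m → (Fin m → ℕ) → ℕ
prodFinℕ zero    f = 1
prodFinℕ (suc m) f = f zero * prodFinℕ m (λ i → f (suc i))

-- Polynomials in ℕ[X₁,…,Xₘ]: finite sums of monomials c · Π Xᵢ^{eᵢ}

Poly : ℕ → Set
Poly m = List (ℕ × (Fin m → ℕ))

evalP : ∀ {m} → Poly m → (Fin m → Seq) → Seq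
evalP {m} p X =
  foldr (λ { (c , e) acc → (embed c ⊗ prodFinP m (λ i → powP (X i) (e i))) ⊕ acc })
        (embed 0) p

evalℕ : ∀ {m} → Poly m → (Fin m → ℕ) → ℕ
evalℕ {m} p x =
  foldr (λ { (c , e) acc → c * prodFinℕ m (λ i → x i ^ e i) + acc }) 0 p

{-# OPTIONS --safe #-}
module Submission where

-- The head map 𝐩 ↦ p₀ is a semiring homomorphism 𝐏 → ℕ, since (𝐩 × 𝐪)₀ = p₀q₀,
-- so a solution in 𝐏ᵐ projects to one in ℕᵐ. Conversely the embedding n ↦ (n)
-- is a homomorphism into profiles: sums and products of sequences with vanishing
-- tails again have vanishing tails, and their heads are computed in ℕ.

open import Defs
open import Data.Nat using (ℕ; zero; suc; _+_; _*_; _∸_; _^_; z≤n; s≤s)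
open import Data.Nat.Properties using (*-comm; m+n∸m≡n)
open import Data.Fin using (Fin; zero; suc)
open import Data.List using ([]; _∷_)
open import Data.Product using (_×_; _,_; ∃-syntax)
open import Function using (_∘_)
open import Function.Bundles using (_⇔_; mk⇔)
open import Relation.Binary.PropositionalEquality

⊗-head : ∀ f g → (f ⊗ g) 0 ≡ f 0 * g 0
⊗-head f g = begin
  (f 0 * g 0 + g 0 * f 0) ∸ f 0 * g 0 ≡⟨ cong (λ t → (f 0 * g 0 + t) ∸ f 0 * g 0) (*-comm (g 0) (f 0)) ⟩
  (f 0 * g 0 + f 0 * g 0) ∸ f 0 * g 0 ≡⟨ m+n∸m≡n (f 0 * g 0) (f 0 * g 0) ⟩
  f 0 * g 0                           ∎
  where open ≡-Reasoning

powP-head : ∀ x k → powP x k 0 ≡ x 0 ^ k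
powP-head x zero    = refl
powP-head x (suc k) = trans (⊗-head x (powP x k)) (cong (x 0 *_) (powP-head x k))

prodFinℕ-cong : ∀ m {f g : Fin m → ℕ} → (∀ i → f i ≡ g i) → prodFinℕ m f ≡ prodFinℕ m g
prodFinℕ-cong zero    f≗g = refl
prodFinℕ-cong (suc m) f≗g = cong₂ _*_ (f≗g zero) (prodFinℕ-cong m (f≗g ∘ suc))

prodFinP-head : ∀ m f → prodFinP m f 0 ≡ prodFinℕ m (λ i → f i 0)
prodFinP-head zero    f = refl
prodFinP-head (suc m) f =
  trans (⊗-head (f zero) (prodFinP m (f ∘ suc))) (cong (f zero 0 *_) (prodFinP-head m (f ∘ suc)))

monomialP-head : ∀ m (X : Fin m → Seq) (e : Fin m → ℕ) →
  prodFinP m (λ i → powP (X i) (e i)) 0 ≡ prodFinℕ m (λ i → X i 0 ^ e i)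
monomialP-head m X e =
  trans (prodFinP-head m (λ i → powP (X i) (e i))) (prodFinℕ-cong m (λ i → powP-head (X i) (e i)))

evalP-head : ∀ {m} (p : Poly m) X → evalP p X 0 ≡ evalℕ p (λ i → X i 0)
evalP-head []                X = refl
evalP-head {m} ((c , e) ∷ p) X = cong₂ _+_
  (trans (⊗-head (embed c) (prodFinP m (λ i → powP (X i) (e i))))
         (cong (c *_) (monomialP-head m X e)))
  (evalP-head p X)

TailVanishes : Seq → Set
TailVanishes f = ∀ j → f (suc j) ≡ 0

embed-tailVanishes : ∀ n → TailVanishes (embed n)
embed-tailVanishes n j = refl

⊕-tailVanishes : ∀ f g → TailVanishes f → TailVanishes g → TailVanishes (f ⊕ g)
⊕-tailVanishes f g f₀ g₀ j rewrite f₀ j | g₀ j = refl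

⊗-tailVanishes : ∀ f g → TailVanishes f → TailVanishes g → TailVanishes (f ⊗ g)
⊗-tailVanishes f g f₀ g₀ j rewrite f₀ j | g₀ j = refl

powP-tailVanishes : ∀ x k → TailVanishes x → TailVanishes (powP x k)
powP-tailVanishes x zero    x₀ = embed-tailVanishes 1
powP-tailVanishes x (suc k) x₀ = ⊗-tailVanishes x (powP x k) x₀ (powP-tailVanishes x k x₀)

prodFinP-tailVanishes : ∀ m f → (∀ i → TailVanishes (f i)) → TailVanishes (prodFinP m f)
prodFinP-tailVanishes zero    f f₀ = embed-tailVanishes 1
prodFinP-tailVanishes (suc m) f f₀ =
  ⊗-tailVanishes (f zero) (prodFinP m (f ∘ suc)) (f₀ zero) (prodFinP-tailVanishes m (f ∘ suc) (f₀ ∘ suc))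

evalP-tailVanishes : ∀ {m} (p : Poly m) X → (∀ i → TailVanishes (X i)) →
  TailVanishes (evalP p X)
evalP-tailVanishes []            X X₀ = embed-tailVanishes 0
evalP-tailVanishes {m} ((c , e) ∷ p) X X₀ = ⊕-tailVanishes (embed c ⊗ monomial) (evalP p X)
  (⊗-tailVanishes (embed c) monomial (embed-tailVanishes c)
    (prodFinP-tailVanishes m (λ i → powP (X i) (e i)) (λ i → powP-tailVanishes (X i) (e i) (X₀ i))))
  (evalP-tailVanishes p X X₀)
  where monomial = prodFinP m (λ i → powP (X i) (e i))

evalP-embed : ∀ {m} (p : Poly m) (x : Fin m → ℕ) k →
  evalP p (embed ∘ x) k ≡ embed (evalℕ p x) k
evalP-embed p x zero    = evalP-head p (embed ∘ x)
evalP-embed p x (suc k) = evalP-tailVanishes p (embed ∘ x) (embed-tailVanishes ∘ x) k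

embed-isProfile : ∀ n → IsProfile (embed n)
embed-isProfile zero    = 0 , (λ i ()) , λ { zero _ → refl ; (suc i) _ → refl }
embed-isProfile (suc n) =
  1 , (λ { zero _ → s≤s z≤n ; (suc i) (s≤s ()) }) , λ { zero () ; (suc i) _ → refl }

lemma8 : ∀ (m : ℕ) (p q : Poly m) →
    (∃[ X ] ((∀ i → IsProfile (X i)) × (∀ k → evalP p X k ≡ evalP q X k)))
    ⇔ (∃[ x ] (evalℕ p x ≡ evalℕ q x))
lemma8 m p q = mk⇔ project embedSolution
  where
  project : ∃[ X ] ((∀ i → IsProfile (X i)) × (∀ k → evalP p X k ≡ evalP q X k)) →
            ∃[ x ] (evalℕ p x ≡ evalℕ q x)
  project (X , _ , p≡q) =
    (λ i → X i 0) , trans (sym (evalP-head p X)) (trans (p≡q 0) (evalP-head q X))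

  embedSolution : ∃[ x ] (evalℕ p x ≡ evalℕ q x) →
                  ∃[ X ] ((∀ i → IsProfile (X i)) × (∀ k → evalP p X k ≡ evalP q X k))
  embedSolution (x , p≡q) = embed ∘ x , embed-isProfile ∘ x , λ k → begin
    evalP p (embed ∘ x) k ≡⟨ evalP-embed p x k ⟩
    embed (evalℕ p x) k   ≡⟨ cong (λ n → embed n k) p≡q ⟩
    embed (evalℕ q x) k   ≡⟨ evalP-embed q x k ⟨
    evalP q (embed ∘ x) k ∎
    where open ≡-Reasoning
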